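{- For every integer $n\ge1$, $$A(n,n-1;u,d)=\sum_{j=0}^{n}|s(n,n-j)|\,u^j,$$ where $s(n,m)$ are the Stirling numbers of the first kind. Moreover, with the convention that the $n=0$ term of the series equals $1$, for $u\ne0$ one has, as formal power series in $t$, $$(1-u\,t)^{ -\frac{1}{u}}=\sum_{n=0}^\infty A(n,n-1;u,d)\frac{t^n}{n!}.$$
   Context: A tile is a positive integer $m$ together with a marker that is absent ($m$), an up-arrow ($m\!\uparrow$) or a down-arrow ($m\!\downarrow$). For $n\ge1$ the set $\mathrm{GS}_n$ of generalized permutations of $[n]$ consists of words of tiles, each with an ascent set $\mathrm{asc}(\pi)$, defined recursively. $\mathrm{GS}_1$ contains only the word consisting of the unmarked tile $1$, with $\mathrm{asc}=\emptyset$. For $n\ge2$, $\mathrm{GS}_n$ consists of all words $\pi'$ obtained from some $\pi=\pi_1\cdots\pi_{n-1}\in\mathrm{GS}_{n-1}$ by one of: (i) insert the unmarked tile $n$ into gap $j$, $0\le j\le n-1$, i.e. $\pi'=\pi_1\cdots\pi_j\, n\,\pi_{j+1}\cdots\pi_{n-1}$; if $j=0$ then $\mathrm{asc}(\pi')=\{a+1: a\in\mathrm{asc}(\pi)\}$, and if $1\le j\le n-1$ then $\mathrm{asc}(\pi')=\{a\in\mathrm{asc}(\pi): a<j\}\cup\{j\}\cup\{a+1: a\in\mathrm{asc}(\pi),\ a>j\}$; (ii) insert $n\!\uparrow$ immediately left of $\pi_i$, $1\le i\le n-1$; then $\mathrm{asc}(\pi')=\{a\in\mathrm{asc}(\pi):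 a<i\}\cup\{i\}\cup\{a+1: a\in\mathrm{asc}(\pi), a\ge i\}$; (iii) insert $n\!\downarrow$ immediately left of $\pi_i$, $1\le i\le n-1$; then $\mathrm{asc}(\pi')=\{a\in\mathrm{asc}(\pi): a<i\}\cup\{a+1: a\in\mathrm{asc}(\pi), a\ge i\}$. For $\pi\in\mathrm{GS}_n$ let $\mathrm{nua}(\pi)$, $\mathrm{nda}(\pi)$ be the numbers of up-arrow and down-arrow tiles of $\pi$. Define $A(n,k;u,d)=\sum u^{\mathrm{nua}(\pi)}d^{\mathrm{nda}(\pi)}$ over all $\pi\in\mathrm{GS}_n$ with $|\mathrm{asc}(\pi)|=k$. -}

module Defs where

open import Data.Nat as ℕ using (ℕ; zero; suc; _∸_)
open import Data.Nat using (_!)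
open import Data.Nat.Properties using (_!≢0)
open import Data.List using (List; []; _∷_; _++_; take; drop; map; filter; concatMap; length; upTo; foldr)
open import Data.Product using (_×_; _,_; proj₁; proj₂)
open import Data.Integer using (+_)
open import Data.Rational as ℚ using (ℚ; 0ℚ; 1ℚ; _+_; _*_; -_; _÷_; ≢-nonZero)
open import Relation.Binary.PropositionalEquality using (_≢_)
open import Relation.Nullary.Decidable using (⌊_⌋)

data Marker : Set where
  none up down : Marker

record Tile : Set where
  constructor tile
  field
    value  : ℕ
    marker : Marker

-- A generalized permutation together with its ascent set (as a list of positions)
GP : Set
GP = List Tile × List ℕ

below : ℕ → List ℕ → List ℕ
below j = filter (λ a → a ℕ.<? j)

atLeastShift : ℕ → List ℕ → List ℕ
atLeastShift i xs = map suc (filter (λ a → i ℕ.≤? a) xs)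

aboveShift : ℕ → List ℕ → List ℕ
aboveShift j xs = map suc (filter (λ a → j ℕ.<? a) xs)

insertAt : ℕ → Tile → List Tile → List Tile
insertAt j t w = take j w ++ (t ∷ drop j w)

ruleI : ℕ → GP → ℕ → GP
ruleI n (w , A) zero    = insertAt 0 (tile n none) w , map suc A
ruleI n (w , A) (suc j) = insertAt (suc j) (tile n none) w ,
                          (below (suc j) A ++ (suc j ∷ aboveShift (suc j) A))

-- rule (ii): insert n↑ immediately left of π_i (i ≥ 1)
ruleII : ℕ → GP → ℕ → GP
ruleII n (w , A) i = insertAt (i ∸ 1) (tile n up) w , (below i A ++ (i ∷ atLeastShift i A))

-- rule (iii): insert n↓ immediately left of π_i (i ≥ 1)
ruleIII : ℕ → GP → ℕ → GP
ruleIII n (w , A) i = insertAt (i ∸ 1) (tile n down) w , (below i A ++ atLeastShift i A)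

children : ℕ → GP → List GP
children n π =
  map (ruleI n π) (upTo n)
  ++ map (ruleII n π) (map suc (upTo (n ∸ 1)))
  ++ map (ruleIII n π) (map suc (upTo (n ∸ 1)))

-- GSsuc m = GS_{m+1}
GSsuc : ℕ → List GP
GSsuc zero    = (tile 1 none ∷ [] , []) ∷ []
GSsuc (suc m) = concatMap (children (suc (suc m))) (GSsuc m)

-- GS n for n ≥ 1 (GS 0 is empty and unused)
GS : ℕ → List GP
GS zero    = []
GS (suc m) = GSsuc m

countUp countDown : List Tile → ℕ
countUp [] = 0
countUp (tile _ up ∷ w) = suc (countUp w)
countUp (tile _ _  ∷ w) = countUp w
countDown [] = 0
countDown (tile _ down ∷ w) = suc (countDown w)
countDown (tile _ _    ∷ w) = countDown w

nua nda : GP → ℕ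
nua π = countUp (proj₁ π)
nda π = countDown (proj₁ π)

asc : GP → List ℕ
asc = proj₂

_^_ : ℚ → ℕ → ℚ
x ^ zero  = 1ℚ
x ^ suc k = x * (x ^ k)

sumℚ : List ℚ → ℚ
sumℚ = foldr _+_ 0ℚ

ℕ→ℚ : ℕ → ℚ
ℕ→ℚ k = (+ k) ℚ./ 1

A : ℕ → ℕ → ℚ → ℚ → ℚ
A n k u d = sumℚ (map (λ π → (u ^ nua π) * (d ^ nda π))
                      (filter (λ π → length (asc π) ℕ.≟ k) (GS n)))

stirling1 : ℕ → ℕ → ℕ
stirling1 zero    zero    = 1
stirling1 zero    (suc k) = 0
stirling1 (suc n) zero    = 0
stirling1 (suc n) (suc k) = n ℕ.* stirling1 n (suc k) ℕ.+ stirling1 n k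

stirlingPoly : ℕ → ℚ → ℚ
stirlingPoly n u = sumℚ (map (λ j → ℕ→ℚ (stirling1 n (n ∸ j)) * (u ^ j)) (upTo (suc n)))

fallingℚ : ℚ → ℕ → ℚ
fallingℚ α zero    = 1ℚ
fallingℚ α (suc n) = fallingℚ α n * (α + - ℕ→ℚ n)

gbinom : ℚ → ℕ → ℚ
gbinom α n = fallingℚ α n * ((+ 1) ℚ./ (n !))
  where instance _ = n !≢0

invFact : ℕ → ℚ
invFact n = (+ 1) ℚ./ (n !)
  where instance _ = n !≢0

-- coefficient of t^n in the binomial series (1 - u t)^α = Σ binom(α,n) (-u t)^n
binomSeriesCoeff : ℚ → ℚ → ℕ → ℚ
binomSeriesCoeff u α n = gbinom α n * ((- u) ^ n)

minusInv : (u : ℚ) → u ≢ 0ℚ → ℚ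
minusInv u u≢0 = - (ℚ.1/ u)
  where instance _ = ≢-nonZero u≢0

Aterm : ℕ → ℚ → ℚ → ℚ
Aterm zero    u d = 1ℚ
Aterm (suc m) u d = A (suc m) m u d

-- coefficient of t^n in Σ_n A(n,n-1;u,d) t^n / n!
egfCoeff : ℚ → ℚ → ℕ → ℚ
egfCoeff u d n = Aterm n u d * invFact n

-- Both statements are reduced to the rising product
--   ρ_n(u) = (1 + 0·u)(1 + 1·u)⋯(1 + (n-1)·u).
--
-- Along the generating rules every word of GS_{m+1} either
-- has fewer than m ascents or has the full ascent set {1,…,m}.  Children of a
-- word with fewer than m ascents have fewer than m+1 ascents.  A word π with
-- full ascent set has m+2 children with full ascent set: the unmarked tile
-- in the last gap (same weight) and the m+1 up-arrow insertions (weight times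
-- u); its other children have at most m ascents.  Hence
-- A(m+2,m+1) = (1 + (m+1)u)·A(m+1,m), i.e. A(n,n-1) = ρ_n(u).
--
-- The recurrence |s(n+1,k+1)| = n|s(n,k+1)| + |s(n,k)| shows that
-- the Stirling polynomial Σ_j |s(n,n-j)| u^j satisfies the same recurrence,
-- so it is ρ_n(u) too; and since (-1/u - i)(-u) = 1 + i·u, the coefficient
-- binom(-1/u,n)(-u)^n of (1-ut)^{-1/u} equals ρ_n(u)/n! = A(n,n-1)/n!.

module Submission where

open import Defs
open import Data.Nat using (ℕ; suc; _∸_; _≤_)
open import Data.Rational using (ℚ; 0ℚ)
open import Data.Product using (_×_; _,_)
open import Relation.Binary.PropositionalEquality using (_≡_; _≢_)

open import Data.Nat as ℕ using (zero; z≤n; s≤s; _<_)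
import Data.Nat.Properties as ℕP
open import Data.Nat.Coprimality using (Coprime; 1-coprimeTo) renaming (sym to coprime-sym)
open import Algebra.Properties.CommutativeSemigroup ℕP.+-commutativeSemigroup using (x∙yz≈y∙xz)
import Data.Integer as ℤ
import Data.Integer.Properties as ℤP
open import Data.Rational as ℚ using (1ℚ; _+_; _*_; -_; mkℚ)
import Data.Rational.Properties as ℚP
open import Data.Rational.Solver using (module +-*-Solver)
open +-*-Solver
open import Data.Sum using (_⊎_; inj₁; inj₂)
open import Data.Empty using (⊥-elim)
open import Data.List using (List; []; _∷_; _++_; _∷ʳ_; map; filter; length; upTo; applyUpTo; concatMap)
import Data.List.Properties as LP
open import Data.List.Relation.Unary.All as All using (All; []; _∷_)
import Data.List.Relation.Unary.All.Properties as AllP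
open import Data.List.Relation.Unary.Any as Any using (Any; here; there)
import Data.List.Relation.Unary.Any.Properties as AnyP
open import Function using (_∘_)
open import Relation.Nullary using (¬_; Dec; yes; no)
open import Relation.Unary using (Decidable)
open import Relation.Binary.PropositionalEquality using (refl; sym; trans; cong; cong₂; subst; module ≡-Reasoning)
open ≡-Reasoning

ℕ→ℚ-suc : ∀ k → ℕ→ℚ (suc k) ≡ 1ℚ + ℕ→ℚ k
ℕ→ℚ-suc k = begin
  ℤ.+ suc k ℚ./ 1
    ≡⟨ ℚP./-cong {ℤ.+ suc k} {1} {ℤ.+ 1 ℤ.* ℤ.+ 1 ℤ.+ ℤ.+ k ℤ.* ℤ.+ 1} {1} numerators refl ⟩
  1ℚ + mkℚ (ℤ.+ k) 0 k/1-coprime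
    ≡⟨ cong (1ℚ +_) (sym (ℚP.normalize-coprime k/1-coprime)) ⟩
  1ℚ + ℕ→ℚ k
    ∎
  where
  k/1-coprime : Coprime k 1
  k/1-coprime = coprime-sym (1-coprimeTo k)
  numerators : ℤ.+ suc k ≡ ℤ.+ 1 ℤ.* ℤ.+ 1 ℤ.+ ℤ.+ k ℤ.* ℤ.+ 1
  numerators = cong (ℤ._+_ (ℤ.+ 1)) (sym (ℤP.*-identityʳ (ℤ.+ k)))

ℕ→ℚ-+ : ∀ a b → ℕ→ℚ (a ℕ.+ b) ≡ ℕ→ℚ a + ℕ→ℚ b
ℕ→ℚ-+ zero    b = sym (ℚP.+-identityˡ (ℕ→ℚ b))
ℕ→ℚ-+ (suc a) b = begin
  ℕ→ℚ (suc (a ℕ.+ b))          ≡⟨ ℕ→ℚ-suc (a ℕ.+ b) ⟩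
  1ℚ + ℕ→ℚ (a ℕ.+ b)           ≡⟨ cong (1ℚ +_) (ℕ→ℚ-+ a b) ⟩
  1ℚ + (ℕ→ℚ a + ℕ→ℚ b)         ≡⟨ sym (ℚP.+-assoc 1ℚ (ℕ→ℚ a) (ℕ→ℚ b)) ⟩
  (1ℚ + ℕ→ℚ a) + ℕ→ℚ b         ≡⟨ cong (_+ ℕ→ℚ b) (sym (ℕ→ℚ-suc a)) ⟩
  ℕ→ℚ (suc a) + ℕ→ℚ b          ∎

ℕ→ℚ-* : ∀ a b → ℕ→ℚ (a ℕ.* b) ≡ ℕ→ℚ a * ℕ→ℚ b
ℕ→ℚ-* zero    b = sym (ℚP.*-zeroˡ (ℕ→ℚ b))
ℕ→ℚ-* (suc a) b = begin
  ℕ→ℚ (b ℕ.+ a ℕ.* b)          ≡⟨ ℕ→ℚ-+ b (a ℕ.* b) ⟩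
  ℕ→ℚ b + ℕ→ℚ (a ℕ.* b)        ≡⟨ cong (ℕ→ℚ b +_) (ℕ→ℚ-* a b) ⟩
  ℕ→ℚ b + ℕ→ℚ a * ℕ→ℚ b        ≡⟨ solve 2 (λ x y → y :+ x :* y := (con 1ℚ :+ x) :* y) refl (ℕ→ℚ a) (ℕ→ℚ b) ⟩
  (1ℚ + ℕ→ℚ a) * ℕ→ℚ b         ≡⟨ cong (_* ℕ→ℚ b) (sym (ℕ→ℚ-suc a)) ⟩
  ℕ→ℚ (suc a) * ℕ→ℚ b          ∎

-- Finite sums Σ_{j<n} f j.  By definition of applyUpTo,
-- sumTo f (suc n) = f 0 + sumTo (f ∘ suc) n holds by computation.
sumTo : (ℕ → ℚ) → ℕ → ℚ
sumTo f n = sumℚ (applyUpTo f n)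

sumℚ-++ : ∀ xs ys → sumℚ (xs ++ ys) ≡ sumℚ xs + sumℚ ys
sumℚ-++ []       ys = sym (ℚP.+-identityˡ (sumℚ ys))
sumℚ-++ (x ∷ xs) ys = trans (cong (x +_) (sumℚ-++ xs ys)) (sym (ℚP.+-assoc x (sumℚ xs) (sumℚ ys)))

sumTo-cong : ∀ {f g : ℕ → ℚ} n → (∀ j → f j ≡ g j) → sumTo f n ≡ sumTo g n
sumTo-cong zero    f≗g = refl
sumTo-cong (suc n) f≗g = cong₂ _+_ (f≗g 0) (sumTo-cong n (f≗g ∘ suc))

sumTo-+ : ∀ (f g : ℕ → ℚ) n → sumTo (λ j → f j + g j) n ≡ sumTo f n + sumTo g n
sumTo-+ f g zero    = refl
sumTo-+ f g (suc n) = begin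
  (f 0 + g 0) + sumTo (λ j → f (suc j) + g (suc j)) n
    ≡⟨ cong ((f 0 + g 0) +_) (sumTo-+ (f ∘ suc) (g ∘ suc) n) ⟩
  (f 0 + g 0) + (F + G)
    ≡⟨ solve 4 (λ a b x y → (a :+ b) :+ (x :+ y) := (a :+ x) :+ (b :+ y)) refl (f 0) (g 0) F G ⟩
  (f 0 + F) + (g 0 + G)
    ∎
  where
  F G : ℚ
  F = sumTo (f ∘ suc) n
  G = sumTo (g ∘ suc) n

sumTo-scale : ∀ a (f : ℕ → ℚ) n → sumTo (λ j → a * f j) n ≡ a * sumTo f n
sumTo-scale a f zero    = sym (ℚP.*-zeroʳ a)
sumTo-scale a f (suc n) = trans (cong (a * f 0 +_) (sumTo-scale a (f ∘ suc) n))
                                (sym (ℚP.*-distribˡ-+ a (f 0) (sumTo (f ∘ suc) n)))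

sumTo-last : ∀ (f : ℕ → ℚ) n → sumTo f (suc n) ≡ sumTo f n + f n
sumTo-last f n = begin
  sumℚ (applyUpTo f (suc n))                 ≡⟨ cong sumℚ (sym (LP.applyUpTo-∷ʳ f n)) ⟩
  sumℚ (applyUpTo f n ∷ʳ f n)                ≡⟨ sumℚ-++ (applyUpTo f n) (f n ∷ []) ⟩
  sumTo f n + (f n + 0ℚ)                     ≡⟨ cong (sumTo f n +_) (ℚP.+-identityʳ (f n)) ⟩
  sumTo f n + f n                            ∎

rising : ℚ → ℕ → ℚ
rising u zero    = 1ℚ
rising u (suc n) = rising u n * (1ℚ + ℕ→ℚ n * u)

stirling1-above : ∀ {n m} → n < m → stirling1 n m ≡ 0
stirling1-above {zero}  {suc m} _         = refl
stirling1-above {suc n} {suc m} (s≤s n<m) = begin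
  n ℕ.* stirling1 n (suc m) ℕ.+ stirling1 n m
    ≡⟨ cong₂ (λ x y → n ℕ.* x ℕ.+ y) (stirling1-above (ℕP.m<n⇒m<1+n n<m)) (stirling1-above n<m) ⟩
  n ℕ.* 0 ℕ.+ 0
    ≡⟨ cong (ℕ._+ 0) (ℕP.*-zeroʳ n) ⟩
  0
    ∎

stirling1-diag : ∀ n → stirling1 n n ≡ 1
stirling1-diag zero    = refl
stirling1-diag (suc n) = begin
  n ℕ.* stirling1 n (suc n) ℕ.+ stirling1 n n
    ≡⟨ cong₂ (λ x y → n ℕ.* x ℕ.+ y) (stirling1-above (ℕP.n<1+n n)) (stirling1-diag n) ⟩
  n ℕ.* 0 ℕ.+ 1
    ≡⟨ cong (ℕ._+ 1) (ℕP.*-zeroʳ n) ⟩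
  1
    ∎

-- The defining recurrence, for a positive first argument and any k
-- (for k = 0 both sides vanish).
stirling1-rec : ∀ n k → stirling1 (suc (suc n)) k ≡ suc n ℕ.* stirling1 (suc n) k ℕ.+ stirling1 (suc n) (ℕ.pred k)
stirling1-rec n zero    = sym (trans (ℕP.+-identityʳ (suc n ℕ.* 0)) (ℕP.*-zeroʳ (suc n)))
stirling1-rec n (suc k) = refl

stirlingTerm : ℚ → ℕ → ℕ → ℚ
stirlingTerm u n j = ℕ→ℚ (stirling1 n (n ∸ j)) * (u ^ j)

stirlingPoly-sumTo : ∀ n u → stirlingPoly n u ≡ sumTo (stirlingTerm u n) (suc n)
stirlingPoly-sumTo n u = cong sumℚ (LP.map-upTo (stirlingTerm u n) (suc n))

stirlingTerm-zero : ∀ u n → stirlingTerm u (suc n) 0 ≡ stirlingTerm u n 0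
stirlingTerm-zero u n = cong (λ s → ℕ→ℚ s * 1ℚ) (trans (stirling1-diag (suc n)) (sym (stirling1-diag n)))

stirlingTerm-suc : ∀ u n j →
  stirlingTerm u (suc (suc n)) (suc j) ≡ (ℕ→ℚ (suc n) * u) * stirlingTerm u (suc n) j + stirlingTerm u (suc n) (suc j)
stirlingTerm-suc u n j = begin
  ℕ→ℚ (stirling1 (suc (suc n)) k) * (u * u ^ j)
    ≡⟨ cong (λ s → ℕ→ℚ s * (u * u ^ j)) (stirling1-rec n k) ⟩
  ℕ→ℚ (suc n ℕ.* stirling1 (suc n) k ℕ.+ stirling1 (suc n) (ℕ.pred k)) * (u * u ^ j)
    ≡⟨ cong (λ i → ℕ→ℚ (suc n ℕ.* stirling1 (suc n) k ℕ.+ stirling1 (suc n) i) * (u * u ^ j)) (ℕP.pred[m∸n]≡m∸[1+n] (suc n) j) ⟩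
  ℕ→ℚ (suc n ℕ.* s₁ ℕ.+ s₂) * (u * u ^ j)
    ≡⟨ cong (_* (u * u ^ j)) (trans (ℕ→ℚ-+ (suc n ℕ.* s₁) s₂) (cong (_+ ℕ→ℚ s₂) (ℕ→ℚ-* (suc n) s₁))) ⟩
  (ℕ→ℚ (suc n) * ℕ→ℚ s₁ + ℕ→ℚ s₂) * (u * u ^ j)
    ≡⟨ solve 5 (λ c x y u p → (c :* x :+ y) :* (u :* p) := (c :* u) :* (x :* p) :+ y :* (u :* p))
               refl (ℕ→ℚ (suc n)) (ℕ→ℚ s₁) (ℕ→ℚ s₂) u (u ^ j) ⟩
  (ℕ→ℚ (suc n) * u) * stirlingTerm u (suc n) j + stirlingTerm u (suc n) (suc j)
    ∎
  where
  k s₁ s₂ : ℕ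
  k  = suc n ∸ j
  s₁ = stirling1 (suc n) k
  s₂ = stirling1 (suc n) (suc n ∸ suc j)

-- The summand j = n+1 vanishes, as |s(n,0)| = 0 for n ≥ 1.
stirlingTerm-beyond : ∀ u n → stirlingTerm u (suc n) (suc (suc n)) ≡ 0ℚ
stirlingTerm-beyond u n rewrite ℕP.m≤n⇒m∸n≡0 (ℕP.n≤1+n n) = ℚP.*-zeroˡ (u ^ suc (suc n))

stirlingPoly-step : ∀ n u → stirlingPoly (suc (suc n)) u ≡ stirlingPoly (suc n) u * (1ℚ + ℕ→ℚ (suc n) * u)
stirlingPoly-step n u = begin
  stirlingPoly (suc (suc n)) u
    ≡⟨ stirlingPoly-sumTo (suc (suc n)) u ⟩
  T₂ 0 + sumTo (T₂ ∘ suc) (suc (suc n))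
    ≡⟨ cong₂ _+_ (stirlingTerm-zero u (suc n)) (sumTo-cong (suc (suc n)) (stirlingTerm-suc u n)) ⟩
  a + sumTo (λ j → cu * T₁ j + T₁ (suc j)) (suc (suc n))
    ≡⟨ cong (a +_) (sumTo-+ (λ j → cu * T₁ j) (T₁ ∘ suc) (suc (suc n))) ⟩
  a + (sumTo (λ j → cu * T₁ j) (suc (suc n)) + sumTo (T₁ ∘ suc) (suc (suc n)))
    ≡⟨ cong (a +_) (cong₂ _+_ (sumTo-scale cu T₁ (suc (suc n))) (sumTo-last (T₁ ∘ suc) (suc n))) ⟩
  a + (cu * (a + S) + (S + T₁ (suc (suc n))))
    ≡⟨ cong (λ t → a + (cu * (a + S) + (S + t))) (stirlingTerm-beyond u n) ⟩
  a + (cu * (a + S) + (S + 0ℚ))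
    ≡⟨ solve 3 (λ a S c → a :+ (c :* (a :+ S) :+ (S :+ con 0ℚ)) := (a :+ S) :* (con 1ℚ :+ c)) refl a S cu ⟩
  (a + S) * (1ℚ + cu)
    ≡⟨ cong (_* (1ℚ + cu)) (sym (stirlingPoly-sumTo (suc n) u)) ⟩
  stirlingPoly (suc n) u * (1ℚ + cu)
    ∎
  where
  T₁ T₂ : ℕ → ℚ
  T₁ = stirlingTerm u (suc n)
  T₂ = stirlingTerm u (suc (suc n))
  cu a S : ℚ
  cu = ℕ→ℚ (suc n) * u
  a  = T₁ 0
  S  = sumTo (T₁ ∘ suc) (suc n)

stirlingPoly≡rising : ∀ n u → stirlingPoly (suc n) u ≡ rising u (suc n)
stirlingPoly≡rising zero    u =
  solve 1 (λ u → con 1ℚ :* con 1ℚ :+ (con 0ℚ :* (u :* con 1ℚ) :+ con 0ℚ)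
                                              := con 1ℚ :* (con 1ℚ :+ con 0ℚ :* u)) refl u
stirlingPoly≡rising (suc n) u =
  trans (stirlingPoly-step n u) (cong (_* (1ℚ + ℕ→ℚ (suc n) * u)) (stirlingPoly≡rising n u))

-- (-1/u)(-1/u - 1)⋯(-1/u - n + 1) · (-u)^n = ρ_n(u): each factor
-- (-1/u - i)(-u) equals 1 + i·u.
falling-minusInv : ∀ u (u≢0 : u ≢ 0ℚ) n → fallingℚ (minusInv u u≢0) n * ((- u) ^ n) ≡ rising u n
falling-minusInv u u≢0 zero    = refl
falling-minusInv u u≢0 (suc n) = begin
  fallingℚ α n * (α + - i) * (- u * (- u) ^ n)
    ≡⟨ solve 5 (λ F P x v i → F :* (:- x :+ :- i) :* (:- v :* P) := (F :* P) :* (x :* v :+ i :* v)) refl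
               (fallingℚ α n) ((- u) ^ n) (ℚ.1/ u) u i ⟩
  (fallingℚ α n * (- u) ^ n) * (ℚ.1/ u * u + i * u)
    ≡⟨ cong₂ (λ p q → p * (q + i * u)) (falling-minusInv u u≢0 n) (ℚP.*-inverseˡ u) ⟩
  rising u n * (1ℚ + i * u)
    ∎
  where
  instance _ = ℚ.≢-nonZero u≢0
  α i : ℚ
  α = minusInv u u≢0
  i = ℕ→ℚ n

Additive : (List Tile → ℕ) → Set
Additive f = ∀ t w → f (t ∷ w) ≡ f (t ∷ []) ℕ.+ f w

additive-insertAt : ∀ f → Additive f → ∀ j t w → f (insertAt j t w) ≡ f (t ∷ w)
additive-insertAt f f+ zero    t w       = refl
additive-insertAt f f+ (suc j) t []      = refl
additive-insertAt f f+ (suc j) t (x ∷ w) = begin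
  f (x ∷ insertAt j t w)          ≡⟨ f+ x (insertAt j t w) ⟩
  f [x] ℕ.+ f (insertAt j t w)     ≡⟨ cong (f [x] ℕ.+_) (trans (additive-insertAt f f+ j t w) (f+ t w)) ⟩
  f [x] ℕ.+ (f [t] ℕ.+ f w)        ≡⟨ x∙yz≈y∙xz (f [x]) (f [t]) (f w) ⟩
  f [t] ℕ.+ (f [x] ℕ.+ f w)        ≡⟨ cong (f [t] ℕ.+_) (sym (f+ x w)) ⟩
  f [t] ℕ.+ f (x ∷ w)              ≡⟨ sym (f+ t (x ∷ w)) ⟩
  f (t ∷ x ∷ w)                    ∎
  where
  [x] [t] : List Tile
  [x] = x ∷ []
  [t] = t ∷ []

countUp-additive : Additive countUp
countUp-additive (tile _ none) w = refl
countUp-additive (tile _ up)   w = refl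
countUp-additive (tile _ down) w = refl

countDown-additive : Additive countDown
countDown-additive (tile _ none) w = refl
countDown-additive (tile _ up)   w = refl
countDown-additive (tile _ down) w = refl

weight : ℚ → ℚ → GP → ℚ
weight u d π = (u ^ nua π) * (d ^ nda π)

weight-ruleI : ∀ u d n w A j → weight u d (ruleI n (w , A) j) ≡ weight u d (w , A)
weight-ruleI u d n w A zero    = refl
weight-ruleI u d n w A (suc j) =
  cong₂ (λ a b → (u ^ a) * (d ^ b)) (additive-insertAt countUp countUp-additive (suc j) (tile n none) w)
                                    (additive-insertAt countDown countDown-additive (suc j) (tile n none) w)

weight-ruleII : ∀ u d n w A i → weight u d (ruleII n (w , A) i) ≡ u * weight u d (w , A)
weight-ruleII u d n w A i = trans
  (cong₂ (λ a b → (u ^ a) * (d ^ b)) (additive-insertAt countUp countUp-additive (i ∸ 1) (tile n up) w)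
                                     (additive-insertAt countDown countDown-additive (i ∸ 1) (tile n up) w))
  (ℚP.*-assoc u (u ^ countUp w) (d ^ countDown w))

module DisjointFilters {P Q : ℕ → Set} (P? : Decidable P) (Q? : Decidable Q) (disjoint : ∀ {a} → P a → ¬ Q a) where

  filters-length≤ : ∀ xs → length (filter P? xs) ℕ.+ length (filter Q? xs) ≤ length xs
  filters-length≤ []       = z≤n
  filters-length≤ (a ∷ xs) with P? a | Q? a
  ... | yes p | yes q = ⊥-elim (disjoint p q)
  ... | yes _ | no  _ = s≤s (filters-length≤ xs)
  ... | no  _ | yes _ = subst (_≤ suc (length xs)) (sym (ℕP.+-suc _ _)) (s≤s (filters-length≤ xs))
  ... | no  _ | no  _ = ℕP.m≤n⇒m≤1+n (filters-length≤ xs)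

  filters-length< : ∀ {xs} → Any (λ a → ¬ P a × ¬ Q a) xs → length (filter P? xs) ℕ.+ length (filter Q? xs) < length xs
  filters-length< {a ∷ xs} (here (¬p , ¬q)) with P? a | Q? a
  ... | yes p | _     = ⊥-elim (¬p p)
  ... | no  _ | yes q = ⊥-elim (¬q q)
  ... | no  _ | no  _ = s≤s (filters-length≤ xs)
  filters-length< {a ∷ xs} (there neither) with P? a | Q? a
  ... | yes p | yes q = ⊥-elim (disjoint p q)
  ... | yes _ | no  _ = s≤s (filters-length< neither)
  ... | no  _ | yes _ = subst (_< suc (length xs)) (sym (ℕP.+-suc _ _)) (s≤s (filters-length< neither))
  ... | no  _ | no  _ = ℕP.m<n⇒m<1+n (filters-length< neither)

  filters-length≡ : (∀ {a} → ¬ P a → Q a) → ∀ xs → length (filter P? xs) ℕ.+ length (filter Q? xs) ≡ length xs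
  filters-length≡ complete []       = refl
  filters-length≡ complete (a ∷ xs) with P? a | Q? a
  ... | yes p | yes q = ⊥-elim (disjoint p q)
  ... | yes _ | no  _ = cong suc (filters-length≡ complete xs)
  ... | no  _ | yes _ = trans (ℕP.+-suc _ _) (cong suc (filters-length≡ complete xs))
  ... | no ¬p | no ¬q = ⊥-elim (¬q (complete ¬p))

module BelowAbove j = DisjointFilters (λ a → a ℕ.<? j) (λ a → j ℕ.<? a) ℕP.<-asym
module BelowAtLeast i = DisjointFilters (λ a → a ℕ.<? i) (λ a → i ℕ.≤? a) ℕP.<⇒≱

ascLength-ruleI-gap : ∀ n w A j →
  length (asc (ruleI n (w , A) (suc j))) ≡ suc (length (below (suc j) A) ℕ.+ length (filter (λ a → suc j ℕ.<? a) A))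
ascLength-ruleI-gap n w A j = begin
  length (below (suc j) A ++ suc j ∷ aboveShift (suc j) A)
    ≡⟨ LP.length-++ (below (suc j) A) ⟩
  length (below (suc j) A) ℕ.+ suc (length (aboveShift (suc j) A))
    ≡⟨ ℕP.+-suc _ _ ⟩
  suc (length (below (suc j) A) ℕ.+ length (aboveShift (suc j) A))
    ≡⟨ cong (λ l → suc (length (below (suc j) A) ℕ.+ l)) (LP.length-map suc (filter (λ a → suc j ℕ.<? a) A)) ⟩
  suc (length (below (suc j) A) ℕ.+ length (filter (λ a → suc j ℕ.<? a) A))
    ∎

ascLength-ruleI≤ : ∀ n w A j → length (asc (ruleI n (w , A) j)) ≤ suc (length A)
ascLength-ruleI≤ n w A zero    = ℕP.m≤n⇒m≤1+n (ℕP.≤-reflexive (LP.length-map suc A))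
ascLength-ruleI≤ n w A (suc j) = subst (_≤ suc (length A)) (sym (ascLength-ruleI-gap n w A j))
                                       (s≤s (BelowAbove.filters-length≤ (suc j) A))

ascLength-ruleII : ∀ n w A i → length (asc (ruleII n (w , A) i)) ≡ suc (length A)
ascLength-ruleII n w A i = begin
  length (below i A ++ i ∷ atLeastShift i A)
    ≡⟨ LP.length-++ (below i A) ⟩
  length (below i A) ℕ.+ suc (length (atLeastShift i A))
    ≡⟨ ℕP.+-suc _ _ ⟩
  suc (length (below i A) ℕ.+ length (atLeastShift i A))
    ≡⟨ cong (λ l → suc (length (below i A) ℕ.+ l)) (LP.length-map suc (filter (λ a → i ℕ.≤? a) A)) ⟩
  suc (length (below i A) ℕ.+ length (filter (λ a → i ℕ.≤? a) A))
    ≡⟨ cong suc (BelowAtLeast.filters-length≡ i ℕP.≮⇒≥ A) ⟩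
  suc (length A)
    ∎

ascLength-ruleIII : ∀ n w A i → length (asc (ruleIII n (w , A) i)) ≡ length A
ascLength-ruleIII n w A i = begin
  length (below i A ++ atLeastShift i A)
    ≡⟨ LP.length-++ (below i A) ⟩
  length (below i A) ℕ.+ length (atLeastShift i A)
    ≡⟨ cong (length (below i A) ℕ.+_) (LP.length-map suc (filter (λ a → i ℕ.≤? a) A)) ⟩
  length (below i A) ℕ.+ length (filter (λ a → i ℕ.≤? a) A)
    ≡⟨ BelowAtLeast.filters-length≡ i ℕP.≮⇒≥ A ⟩
  length A
    ∎

fullAsc : ℕ → List ℕ
fullAsc zero    = []
fullAsc (suc m) = fullAsc m ∷ʳ suc m

length-fullAsc : ∀ m → length (fullAsc m) ≡ m
length-fullAsc zero    = refl
length-fullAsc (suc m) = trans (LP.length-++ (fullAsc m)) (trans (cong (ℕ._+ 1) (length-fullAsc m)) (ℕP.+-comm m 1))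

fullAsc-∋ : ∀ {i m} → 1 ≤ i → i ≤ m → Any (i ≡_) (fullAsc m)
fullAsc-∋ {suc i} {zero}  _   ()
fullAsc-∋ {i}     {suc m} 1≤i i≤1+m with ℕP.m≤n⇒m<n∨m≡n i≤1+m
... | inj₁ (s≤s i≤m) = AnyP.++⁺ˡ (fullAsc-∋ 1≤i i≤m)
... | inj₂ refl      = AnyP.++⁺ʳ (fullAsc m) (here refl)

module _ {P : ℕ → Set} (P? : Decidable P) where

  filter-fullAsc-all : ∀ m → (∀ {a} → a ≤ m → P a) → filter P? (fullAsc m) ≡ fullAsc m
  filter-fullAsc-all zero    _   = refl
  filter-fullAsc-all (suc m) always = begin
    filter P? (fullAsc m ++ suc m ∷ [])
      ≡⟨ LP.filter-++ P? (fullAsc m) (suc m ∷ []) ⟩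
    filter P? (fullAsc m) ++ filter P? (suc m ∷ [])
      ≡⟨ cong₂ _++_ (filter-fullAsc-all m (λ a≤m → always (ℕP.m≤n⇒m≤1+n a≤m)))
        (LP.filter-accept P? (always ℕP.≤-refl)) ⟩
    fullAsc m ++ suc m ∷ []
      ∎

  filter-fullAsc-never : ∀ m → (∀ {a} → a ≤ m → ¬ P a) → filter P? (fullAsc m) ≡ []
  filter-fullAsc-never zero    _    = refl
  filter-fullAsc-never (suc m) never = begin
    filter P? (fullAsc m ++ suc m ∷ [])
      ≡⟨ LP.filter-++ P? (fullAsc m) (suc m ∷ []) ⟩
    filter P? (fullAsc m) ++ filter P? (suc m ∷ [])
      ≡⟨ cong₂ _++_ (filter-fullAsc-never m (λ a≤m → never (ℕP.m≤n⇒m≤1+n a≤m)))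
        (LP.filter-reject P? (never ℕP.≤-refl)) ⟩
    []
      ∎

ruleII-fullAsc : ∀ m {i} → 1 ≤ i → i ≤ suc m → below i (fullAsc m) ++ i ∷ atLeastShift i (fullAsc m) ≡ fullAsc (suc m)
ruleII-fullAsc m {i} 1≤i i≤1+m with ℕP.m≤n⇒m<n∨m≡n i≤1+m
... | inj₂ refl = cong₂ (λ xs ys → xs ++ suc m ∷ map suc ys)
                        (filter-fullAsc-all (λ a → a ℕ.<? suc m) m s≤s)
                        (filter-fullAsc-never (λ a → suc m ℕ.≤? a) m (λ a≤m → ℕP.<⇒≱ (s≤s a≤m)))
ruleII-fullAsc zero    (s≤s _) _ | inj₁ (s≤s ())
ruleII-fullAsc (suc m) {i} 1≤i _ | inj₁ (s≤s i≤1+m) = begin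
  below i (fullAsc m ∷ʳ suc m) ++ i ∷ map suc (filter (λ a → i ℕ.≤? a) (fullAsc m ∷ʳ suc m))
    ≡⟨ cong₂ (λ xs ys → xs ++ i ∷ map suc ys) belowLast atLeastLast ⟩
  below i (fullAsc m) ++ i ∷ map suc (filter (λ a → i ℕ.≤? a) (fullAsc m) ∷ʳ suc m)
    ≡⟨ cong (λ ys → below i (fullAsc m) ++ i ∷ ys) (LP.map-++ suc (filter (λ a → i ℕ.≤? a) (fullAsc m)) (suc m ∷ [])) ⟩
  below i (fullAsc m) ++ i ∷ (atLeastShift i (fullAsc m) ∷ʳ suc (suc m))
    ≡⟨ sym (LP.++-assoc (below i (fullAsc m)) (i ∷ atLeastShift i (fullAsc m)) (suc (suc m) ∷ [])) ⟩
  (below i (fullAsc m) ++ i ∷ atLeastShift i (fullAsc m)) ∷ʳ suc (suc m)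
    ≡⟨ cong (_∷ʳ suc (suc m)) (ruleII-fullAsc m 1≤i i≤1+m) ⟩
  fullAsc (suc (suc m))
    ∎
  where
  belowLast : below i (fullAsc m ∷ʳ suc m) ≡ below i (fullAsc m)
  belowLast = trans (LP.filter-++ (λ a → a ℕ.<? i) (fullAsc m) (suc m ∷ []))
                    (trans (cong (below i (fullAsc m) ++_) (LP.filter-reject (λ a → a ℕ.<? i) (ℕP.≤⇒≯ i≤1+m)))
                           (LP.++-identityʳ (below i (fullAsc m))))
  atLeastLast : filter (λ a → i ℕ.≤? a) (fullAsc m ∷ʳ suc m) ≡ filter (λ a → i ℕ.≤? a) (fullAsc m) ∷ʳ suc m
  atLeastLast = trans (LP.filter-++ (λ a → i ℕ.≤? a) (fullAsc m) (suc m ∷ []))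
                      (cong (filter (λ a → i ℕ.≤? a) (fullAsc m) ++_) (LP.filter-accept (λ a → i ℕ.≤? a) i≤1+m))

ruleI-last-fullAsc : ∀ m w → asc (ruleI (suc (suc m)) (w , fullAsc m) (suc m)) ≡ fullAsc (suc m)
ruleI-last-fullAsc m w = cong₂ (λ xs ys → xs ++ suc m ∷ map suc ys)
  (filter-fullAsc-all (λ a → a ℕ.<? suc m) m s≤s)
  (filter-fullAsc-never (λ a → suc m ℕ.<? a) m (λ a≤m → ℕP.≤⇒≯ (ℕP.m≤n⇒m≤1+n a≤m)))

-- Any other gap loses an ascent: the new ascent at j+1 replaces the old one.
ruleI-inner-fullAsc : ∀ m w j → j ≤ m → length (asc (ruleI (suc (suc m)) (w , fullAsc m) j)) < suc m
ruleI-inner-fullAsc m w zero    _ = s≤s (ℕP.≤-reflexive (trans (LP.length-map suc (fullAsc m)) (length-fullAsc m)))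
ruleI-inner-fullAsc m w (suc j) 1+j≤m = subst (_< suc m) (sym (ascLength-ruleI-gap (suc (suc m)) w (fullAsc m) j))
  (s≤s (ℕP.<-≤-trans (BelowAbove.filters-length< (suc j) neither) (ℕP.≤-reflexive (length-fullAsc m))))
  where
  neither : Any (λ a → ¬ a < suc j × ¬ suc j < a) (fullAsc m)
  neither = Any.map (λ { refl → ℕP.<-irrefl refl , ℕP.<-irrefl refl }) (fullAsc-∋ (s≤s z≤n) 1+j≤m)

ASum : ℚ → ℚ → ℕ → List GP → ℚ
ASum u d k xs = sumℚ (map (weight u d) (filter (λ π → length (asc π) ℕ.≟ k) xs))

ASum-++ : ∀ u d k xs ys → ASum u d k (xs ++ ys) ≡ ASum u d k xs + ASum u d k ys
ASum-++ u d k xs ys = begin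
  sumℚ (map (weight u d) (filter k? (xs ++ ys)))
    ≡⟨ cong (sumℚ ∘ map (weight u d)) (LP.filter-++ k? xs ys) ⟩
  sumℚ (map (weight u d) (filter k? xs ++ filter k? ys))
    ≡⟨ cong sumℚ (LP.map-++ (weight u d) (filter k? xs) (filter k? ys)) ⟩
  sumℚ (map (weight u d) (filter k? xs) ++ map (weight u d) (filter k? ys))
                                                                    ≡⟨ sumℚ-++ (map (weight u d) (filter k? xs)) _ ⟩
  ASum u d k xs + ASum u d k ys
    ∎
  where
  k? : (π : GP) → Dec (length (asc π) ≡ k)
  k? π = length (asc π) ℕ.≟ k

ASum-none : ∀ u d k xs → All (λ π → length (asc π) ≢ k) xs → ASum u d k xs ≡ 0ℚ
ASum-none u d k xs wrong =
  cong (λ ys → sumℚ (map (weight u d) ys)) (LP.filter-none (λ π → length (asc π) ℕ.≟ k) wrong)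

ASum-const : ∀ u d k v xs → All (λ π → length (asc π) ≡ k × weight u d π ≡ v) xs → ASum u d k xs ≡ ℕ→ℚ (length xs) * v
ASum-const u d k v []       []                = sym (ℚP.*-zeroˡ v)
ASum-const u d k v (π ∷ xs) ((len , wt) ∷ rest) = begin
  ASum u d k (π ∷ xs)
    ≡⟨ cong (λ ys → sumℚ (map (weight u d) ys)) (LP.filter-accept (λ π → length (asc π) ℕ.≟ k) {π} {xs} len) ⟩
  weight u d π + ASum u d k xs
    ≡⟨ cong₂ _+_ wt (ASum-const u d k v xs rest) ⟩
  v + ℕ→ℚ (length xs) * v
    ≡⟨ solve 2 (λ v c → v :+ c :* v := (con 1ℚ :+ c) :* v) refl v (ℕ→ℚ (length xs)) ⟩
  (1ℚ + ℕ→ℚ (length xs)) * v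
    ≡⟨ cong (_* v) (sym (ℕ→ℚ-suc (length xs))) ⟩
  ℕ→ℚ (suc (length xs)) * v
    ∎

all-upTo : ∀ {X : Set} {P : X → Set} (g : ℕ → X) k → (∀ j → j < k → P (g j)) → All P (map g (upTo k))
all-upTo g k h = AllP.map⁺ (AllP.applyUpTo⁺₁ (λ i → i) k (λ {i} → h i))

all-sucUpTo : ∀ {X : Set} {P : X → Set} (g : ℕ → X) k → (∀ j → j < k → P (g (suc j))) → All P (map g (map suc (upTo k)))
all-sucUpTo {P = P} g k h = AllP.map⁺ (all-upTo {P = P ∘ g} suc k h)

children-short : ∀ m w A → length A < m → All (λ c → length (asc c) < suc m) (children (suc (suc m)) (w , A))
children-short m w A |A|<m =
  AllP.++⁺ (all-upTo (ruleI n π) n viaI) (AllP.++⁺ (all-sucUpTo (ruleII n π) (suc m) viaII) (all-sucUpTo (ruleIII n π) (suc m) viaIII))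
  where
  n : ℕ
  n = suc (suc m)
  π : GP
  π = w , A
  viaI : ∀ j → j < n → length (asc (ruleI n π j)) < suc m
  viaI j _ = s≤s (ℕP.≤-trans (ascLength-ruleI≤ n w A j) |A|<m)
  viaII : ∀ j → j < suc m → length (asc (ruleII n π (suc j))) < suc m
  viaII j _ = s≤s (ℕP.≤-trans (ℕP.≤-reflexive (ascLength-ruleII n w A (suc j))) |A|<m)
  viaIII : ∀ j → j < suc m → length (asc (ruleIII n π (suc j))) < suc m
  viaIII j _ = ℕP.m<n⇒m<1+n (ℕP.≤-<-trans (ℕP.≤-reflexive (ascLength-ruleIII n w A (suc j))) |A|<m)

ShortOrFull : ℕ → GP → Set
ShortOrFull m π = length (asc π) < m ⊎ asc π ≡ fullAsc m

module FullParent (m : ℕ) (w : List Tile) where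
  n : ℕ
  n = suc (suc m)
  π : GP
  π = w , fullAsc m

  full-ruleII : ∀ j → j < suc m → asc (ruleII n π (suc j)) ≡ fullAsc (suc m)
  full-ruleII j j<1+m = ruleII-fullAsc m (s≤s z≤n) j<1+m

  short-ruleIII : ∀ i → length (asc (ruleIII n π i)) < suc m
  short-ruleIII i = s≤s (ℕP.≤-reflexive (trans (ascLength-ruleIII n w (fullAsc m) i) (length-fullAsc m)))

  children-ShortOrFull : All (ShortOrFull (suc m)) (children n π)
  children-ShortOrFull = AllP.++⁺ (all-upTo (ruleI n π) n ruleI-case)
    (AllP.++⁺ (all-sucUpTo (ruleII n π) (suc m) (λ j j<1+m → inj₂ (full-ruleII j j<1+m)))
              (all-sucUpTo (ruleIII n π) (suc m) (λ j _ → inj₁ (short-ruleIII (suc j)))))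
    where
    ruleI-case : ∀ j → j < n → ShortOrFull (suc m) (ruleI n π j)
    ruleI-case j (s≤s j≤1+m) with ℕP.m≤n⇒m<n∨m≡n j≤1+m
    ... | inj₁ (s≤s j≤m) = inj₁ (ruleI-inner-fullAsc m w j j≤m)
    ... | inj₂ refl      = inj₂ (ruleI-last-fullAsc m w)

  -- Rule (i): only the insertion into the last gap keeps the full ascent
  -- set, and it keeps the weight.
  ASum-ruleI : ∀ u d → ASum u d (suc m) (map (ruleI n π) (upTo n)) ≡ weight u d π
  ASum-ruleI u d = begin
    ASum u d (suc m) (map (ruleI n π) (upTo n))
      ≡⟨ cong (ASum u d (suc m) ∘ map (ruleI n π)) (sym (LP.upTo-∷ʳ (suc m))) ⟩
    ASum u d (suc m) (map (ruleI n π) (upTo (suc m) ∷ʳ suc m))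
      ≡⟨ cong (ASum u d (suc m)) (LP.map-++ (ruleI n π) (upTo (suc m)) (suc m ∷ [])) ⟩
    ASum u d (suc m) (inner ++ ruleI n π (suc m) ∷ [])
      ≡⟨ ASum-++ u d (suc m) inner (ruleI n π (suc m) ∷ []) ⟩
    ASum u d (suc m) inner + ASum u d (suc m) (ruleI n π (suc m) ∷ [])
      ≡⟨ cong₂ _+_ (ASum-none u d (suc m) inner (all-upTo (ruleI n π) (suc m) inner-short))
                   (ASum-const u d (suc m) (weight u d π) (ruleI n π (suc m) ∷ []) (last ∷ [])) ⟩
    0ℚ + 1ℚ * weight u d π
      ≡⟨ trans (ℚP.+-identityˡ _) (ℚP.*-identityˡ (weight u d π)) ⟩
    weight u d π
      ∎
    where
    inner : List GP
    inner = map (ruleI n π) (upTo (suc m))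
    inner-short : ∀ j → j < suc m → length (asc (ruleI n π j)) ≢ suc m
    inner-short j j<1+m = ℕP.<⇒≢ (ruleI-inner-fullAsc m w j (ℕP.≤-pred j<1+m))
    last : length (asc (ruleI n π (suc m))) ≡ suc m × weight u d (ruleI n π (suc m)) ≡ weight u d π
    last = trans (cong length (ruleI-last-fullAsc m w)) (length-fullAsc (suc m)) , weight-ruleI u d n w (fullAsc m) (suc m)

  -- Rule (ii): all m+1 insertions keep the full ascent set, each with weight u·W.
  ASum-ruleII : ∀ u d → ASum u d (suc m) (map (ruleII n π) (map suc (upTo (suc m)))) ≡ ℕ→ℚ (suc m) * (u * weight u d π)
  ASum-ruleII u d = trans (ASum-const u d (suc m) (u * weight u d π) II (all-sucUpTo (ruleII n π) (suc m) full-weighted))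
                          (cong (λ l → ℕ→ℚ l * (u * weight u d π)) |II|≡1+m)
    where
    II : List GP
    II = map (ruleII n π) (map suc (upTo (suc m)))
    full-weighted : ∀ j → j < suc m →
      length (asc (ruleII n π (suc j))) ≡ suc m × weight u d (ruleII n π (suc j)) ≡ u * weight u d π
    full-weighted j j<1+m = trans (cong length (full-ruleII j j<1+m)) (length-fullAsc (suc m))
                          , weight-ruleII u d n w (fullAsc m) (suc j)
    |II|≡1+m : length II ≡ suc m
    |II|≡1+m = trans (LP.length-map (ruleII n π) (map suc (upTo (suc m))))
                     (trans (LP.length-map suc (upTo (suc m))) (LP.length-upTo (suc m)))

  -- Rule (iii): no insertion keeps the full ascent set.
  ASum-ruleIII : ∀ u d → ASum u d (suc m) (map (ruleIII n π) (map suc (upTo (suc m)))) ≡ 0ℚ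
  ASum-ruleIII u d = ASum-none u d (suc m) _ (all-sucUpTo (ruleIII n π) (suc m) (λ j _ → ℕP.<⇒≢ (short-ruleIII (suc j))))

  ASum-children : ∀ u d → ASum u d (suc m) (children n π) ≡ (1ℚ + ℕ→ℚ (suc m) * u) * weight u d π
  ASum-children u d = begin
    ASum u d (suc m) (I ++ (II ++ III))
      ≡⟨ trans (ASum-++ u d (suc m) I (II ++ III)) (cong (ASum u d (suc m) I +_) (ASum-++ u d (suc m) II III)) ⟩
    ASum u d (suc m) I + (ASum u d (suc m) II + ASum u d (suc m) III)
      ≡⟨ cong₂ _+_ (ASum-ruleI u d) (cong₂ _+_ (ASum-ruleII u d) (ASum-ruleIII u d)) ⟩
    W + (ℕ→ℚ (suc m) * (u * W) + 0ℚ)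
      ≡⟨ solve 3 (λ W c u → W :+ (c :* (u :* W) :+ con 0ℚ) := (con 1ℚ :+ c :* u) :* W) refl W (ℕ→ℚ (suc m)) u ⟩
    (1ℚ + ℕ→ℚ (suc m) * u) * W
      ∎
    where
    I II III : List GP
    I   = map (ruleI n π) (upTo n)
    II  = map (ruleII n π) (map suc (upTo (suc m)))
    III = map (ruleIII n π) (map suc (upTo (suc m)))
    W : ℚ
    W = weight u d π

-- One generation step: under the invariant, the words with m+1 ascents among
-- the children come exactly from the words with full ascent set, each with
-- factor 1 + (m+1)u.
ASum-step : ∀ u d m xs → All (ShortOrFull m) xs →
  ASum u d (suc m) (concatMap (children (suc (suc m))) xs) ≡ (1ℚ + ℕ→ℚ (suc m) * u) * ASum u d m xs
ASum-step u d m [] [] = sym (ℚP.*-zeroʳ (1ℚ + ℕ→ℚ (suc m) * u))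
ASum-step u d m ((w , A) ∷ xs) (inj₁ short ∷ rest) = begin
  ASum u d (suc m) (children (suc (suc m)) (w , A) ++ concatMap (children (suc (suc m))) xs)
    ≡⟨ ASum-++ u d (suc m) (children (suc (suc m)) (w , A)) _ ⟩
  ASum u d (suc m) (children (suc (suc m)) (w , A)) + ASum u d (suc m) (concatMap (children (suc (suc m))) xs)
    ≡⟨ cong₂ _+_ (ASum-none u d (suc m) _ (All.map ℕP.<⇒≢ (children-short m w A short)))
                 (ASum-step u d m xs rest) ⟩
  0ℚ + c * ASum u d m xs
    ≡⟨ ℚP.+-identityˡ _ ⟩
  c * ASum u d m xs
    ≡⟨ cong (λ ys → c * sumℚ (map (weight u d) ys))
            (sym (LP.filter-reject (λ π → length (asc π) ℕ.≟ m) {w , A} {xs} (ℕP.<⇒≢ short))) ⟩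
  c * ASum u d m ((w , A) ∷ xs)
    ∎
  where
  c : ℚ
  c = 1ℚ + ℕ→ℚ (suc m) * u
ASum-step u d m ((w , A) ∷ xs) (inj₂ refl ∷ rest) = begin
  ASum u d (suc m) (children (suc (suc m)) (w , fullAsc m) ++ concatMap (children (suc (suc m))) xs)
    ≡⟨ ASum-++ u d (suc m) (children (suc (suc m)) (w , fullAsc m)) _ ⟩
  ASum u d (suc m) (children (suc (suc m)) (w , fullAsc m)) + ASum u d (suc m) (concatMap (children (suc (suc m))) xs)
    ≡⟨ cong₂ _+_ (FullParent.ASum-children m w u d) (ASum-step u d m xs rest) ⟩
  c * weight u d (w , fullAsc m) + c * ASum u d m xs
    ≡⟨ sym (ℚP.*-distribˡ-+ c (weight u d (w , fullAsc m)) (ASum u d m xs)) ⟩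
  c * (weight u d (w , fullAsc m) + ASum u d m xs)
    ≡⟨ cong (λ ys → c * sumℚ (map (weight u d) ys))
            (sym (LP.filter-accept (λ π → length (asc π) ℕ.≟ m) {w , fullAsc m} {xs} (length-fullAsc m))) ⟩
  c * ASum u d m ((w , fullAsc m) ∷ xs)
    ∎
  where
  c : ℚ
  c = 1ℚ + ℕ→ℚ (suc m) * u

ShortOrFull-step : ∀ m xs → All (ShortOrFull m) xs → All (ShortOrFull (suc m)) (concatMap (children (suc (suc m))) xs)
ShortOrFull-step m []             []                  = []
ShortOrFull-step m ((w , A) ∷ xs) (inj₁ short ∷ rest) =
  AllP.++⁺ (All.map inj₁ (children-short m w A short)) (ShortOrFull-step m xs rest)
ShortOrFull-step m ((w , A) ∷ xs) (inj₂ refl ∷ rest)  =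
  AllP.++⁺ (FullParent.children-ShortOrFull m w) (ShortOrFull-step m xs rest)

GS-ShortOrFull : ∀ m → All (ShortOrFull m) (GSsuc m)
GS-ShortOrFull zero    = inj₂ refl ∷ []
GS-ShortOrFull (suc m) = ShortOrFull-step m (GSsuc m) (GS-ShortOrFull m)

A≡rising : ∀ m u d → A (suc m) m u d ≡ rising u (suc m)
A≡rising zero    u d = -- GS_1 is the single word 1, of weight 1
  solve 1 (λ u → con 1ℚ :* con 1ℚ :+ con 0ℚ := con 1ℚ :* (con 1ℚ :+ con 0ℚ :* u)) refl u
A≡rising (suc m) u d = begin
  ASum u d (suc m) (concatMap (children (suc (suc m))) (GSsuc m))  ≡⟨ ASum-step u d m (GSsuc m) (GS-ShortOrFull m) ⟩
  c * A (suc m) m u d                                             ≡⟨ cong (c *_) (A≡rising m u d) ⟩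
  c * rising u (suc m)                                            ≡⟨ ℚP.*-comm c (rising u (suc m)) ⟩
  rising u (suc (suc m))                                          ∎
  where
  c : ℚ
  c = 1ℚ + ℕ→ℚ (suc m) * u

Aterm≡rising : ∀ n u d → Aterm n u d ≡ rising u n
Aterm≡rising zero    u d = refl
Aterm≡rising (suc m) u d = A≡rising m u d

mainTheorem6 : ((n : ℕ) → 1 ≤ n → (u d : ℚ) → A n (n ∸ 1) u d ≡ stirlingPoly n u)
    × ((u d : ℚ) → (u≢0 : u ≢ 0ℚ) → (n : ℕ) →
         binomSeriesCoeff u (minusInv u u≢0) n ≡ egfCoeff u d n)
mainTheorem6 = stirling , binomialSeries
  where
  stirling : (n : ℕ) → 1 ≤ n → (u d : ℚ) → A n (n ∸ 1) u d ≡ stirlingPoly n u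
  stirling (suc m) _ u d = trans (A≡rising m u d) (sym (stirlingPoly≡rising m u))

  binomialSeries : (u d : ℚ) → (u≢0 : u ≢ 0ℚ) → (n : ℕ) → binomSeriesCoeff u (minusInv u u≢0) n ≡ egfCoeff u d n
  binomialSeries u d u≢0 n = begin
    fallingℚ α n * invFact n * (- u) ^ n
      ≡⟨ solve 3 (λ F i p → (F :* i) :* p := (F :* p) :* i) refl (fallingℚ α n) (invFact n) ((- u) ^ n) ⟩
    fallingℚ α n * (- u) ^ n * invFact n
      ≡⟨ cong (_* invFact n) (falling-minusInv u u≢0 n) ⟩
    rising u n * invFact n
      ≡⟨ cong (_* invFact n) (sym (Aterm≡rising n u d)) ⟩
    egfCoeff u d n
      ∎
    where
    α : ℚ
    α = minusInv u u≢0
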